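{- Let $\mathbf A=(A,\le,0,1)$ be a bounded poset, $T$ a nonempty set, and $P,G:\mathcal P_+(A^T)\to(\mathcal P_+A)^T$ maps. The following are equivalent: 1. $P,G$ form a Galois connection, i.e. for all $C,D\in\mathcal P_+(A^T)$: $P(C)\le_2 D$ if and only if $C\le_1 G(D)$. 2. $P,G$ satisfy (T1) and (T2): for all $C,D\in\mathcal P_+(A^T)$, (T1) if $C\le_1 D$ then $P(C)\le_2P(D)$, and if $C\le_2D$ then $G(C)\le_1G(D)$; (T2) $C\le_1(G*P)(C)$ and $(P*G)(C)\le_2 C$.
   Context: $\mathcal P_+(X)$ = nonempty subsets of $X$. $A^T$ is ordered componentwise. For subsets $X,Y$ of $A^T$: $X\le_1Y$ iff every $x\in X$ lies below some $y\in Y$; $X\le_2Y$ iff every $y\in Y$ lies above some $x\in X$. Each $Z\in(\mathcal P_+A)^T$ is identified with the subset $\varphi(Z)=\{q\in A^T\mid q(t)\in Z(t)\ \forall t\in T\}$ of $A^T$ for comparisons. For maps $X,Y:\mathcal P_+(A^T)\to(\mathcal P_+A)^T$, $X*Y=X\circ\varphi\circ Y$. -}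

module Defs where

open import Level using (Level; _⊔_) renaming (suc to lsuc)
open import Relation.Binary.Bundles using (Poset)
open import Relation.Binary.Definitions using (Minimum; Maximum)
open import Relation.Unary using (Pred; _∈_)
open import Data.Product using (Σ; ∃; _×_; _,_; proj₁; proj₂)

record BoundedPoset (c ℓ₁ ℓ₂ : Level) : Set (lsuc (c ⊔ ℓ₁ ⊔ ℓ₂)) where
  field
    poset : Poset c ℓ₁ ℓ₂
  open Poset poset public
  field
    0# 1#   : Carrier
    minimum : Minimum _≤_ 0#
    maximum : Maximum _≤_ 1#

record 𝒫₊ {a : Level} (X : Set a) (ℓ : Level) : Set (a ⊔ lsuc ℓ) where
  constructor ⟨_,_⟩
  field
    set      : Pred X ℓ
    nonempty : ∃ λ x → x ∈ set
open 𝒫₊ public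

module _ {c ℓ₁ ℓ₂ : Level} (𝔸 : BoundedPoset c ℓ₁ ℓ₂) (T : Set c) where
  open BoundedPoset 𝔸

  _≤ᵀ_ : (T → Carrier) → (T → Carrier) → Set (c ⊔ ℓ₂)
  f ≤ᵀ g = ∀ t → f t ≤ g t

  _≤₁_ : Pred (T → Carrier) c → Pred (T → Carrier) c → Set (c ⊔ ℓ₂)
  X ≤₁ Y = ∀ x → x ∈ X → ∃ λ y → y ∈ Y × x ≤ᵀ y

  _≤₂_ : Pred (T → Carrier) c → Pred (T → Carrier) c → Set (c ⊔ ℓ₂)
  X ≤₂ Y = ∀ y → y ∈ Y → ∃ λ x → x ∈ X × x ≤ᵀ y

  Tuple : Set (lsuc c)
  Tuple = T → 𝒫₊ Carrier c

  Map : Set (lsuc c)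
  Map = 𝒫₊ (T → Carrier) c → Tuple

  φ : Tuple → Pred (T → Carrier) c
  φ Z q = ∀ t → q t ∈ set (Z t)

  φ₊ : Tuple → 𝒫₊ (T → Carrier) c
  φ₊ Z = ⟨ φ Z , ((λ t → proj₁ (nonempty (Z t))) , (λ t → proj₂ (nonempty (Z t)))) ⟩

  _*_ : Map → Map → Map
  (X * Y) C = X (φ₊ (Y C))

  record GaloisConnection (P G : Map) : Set (lsuc c ⊔ ℓ₂) where
    field
      to   : ∀ C D → φ (P C) ≤₂ set D → set C ≤₁ φ (G D)
      from : ∀ C D → set C ≤₁ φ (G D) → φ (P C) ≤₂ set D

  record T1 (P G : Map) : Set (lsuc c ⊔ ℓ₂) where
    field
      P-mono : ∀ C D → set C ≤₁ set D → φ (P C) ≤₂ φ (P D)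
      G-mono : ∀ C D → set C ≤₂ set D → φ (G C) ≤₁ φ (G D)

  record T2 (P G : Map) : Set (lsuc c ⊔ ℓ₂) where
    field
      GP-ext : ∀ C → set C ≤₁ φ ((G * P) C)
      PG-int : ∀ C → φ ((P * G) C) ≤₂ set C

{-# OPTIONS --safe #-}
-- ≤₁ and ≤₂ are preorders, and composing with φ makes P monotone from ≤₁ to ≤₂
-- and G monotone from ≤₂ to ≤₁. The theorem is then the classical
-- characterisation of a Galois connection between preorders: the unit C ≤₁ GP(C)
-- and counit PG(D) ≤₂ D are the two halves of the adjunction applied to the
-- reflexive instances, monotonicity follows by composing with them, and
-- conversely monotonicity plus unit and counit give back both halves by
-- transitivity.
module Submission where

open import Defs
open import Level using (Level)
open import Data.Product using (_×_; _,_; uncurry)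
open import Function.Bundles using (_⇔_; mk⇔)

module _ {c ℓ₁ ℓ₂ : Level} (𝔸 : BoundedPoset c ℓ₁ ℓ₂) (T : Set c) where
  open BoundedPoset 𝔸 using (refl; trans)

  ≤₁-refl : ∀ X → _≤₁_ 𝔸 T X X
  ≤₁-refl X x x∈X = x , x∈X , λ t → refl

  ≤₂-refl : ∀ X → _≤₂_ 𝔸 T X X
  ≤₂-refl X y y∈X = y , y∈X , λ t → refl

  ≤₁-trans : ∀ X Y Z → _≤₁_ 𝔸 T X Y → _≤₁_ 𝔸 T Y Z → _≤₁_ 𝔸 T X Z
  ≤₁-trans X Y Z X≤Y Y≤Z x x∈X with X≤Y x x∈X
  ... | y , y∈Y , x≤y with Y≤Z y y∈Y
  ...   | z , z∈Z , y≤z = z , z∈Z , λ t → trans (x≤y t) (y≤z t)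

  ≤₂-trans : ∀ X Y Z → _≤₂_ 𝔸 T X Y → _≤₂_ 𝔸 T Y Z → _≤₂_ 𝔸 T X Z
  ≤₂-trans X Y Z X≤Y Y≤Z z z∈Z with Y≤Z z z∈Z
  ... | y , y∈Y , y≤z with X≤Y y y∈Y
  ...   | x , x∈X , x≤y = x , x∈X , λ t → trans (x≤y t) (y≤z t)

  module _ {P G : Map 𝔸 T} where
    private
      ⟦_⟧ : Tuple 𝔸 T → 𝒫₊ (T → BoundedPoset.Carrier 𝔸) c
      ⟦_⟧ = φ₊ 𝔸 T

    galois⇒T2 : GaloisConnection 𝔸 T P G → T2 𝔸 T P G
    galois⇒T2 gc = record
      { GP-ext = λ C → to C ⟦ P C ⟧ (≤₂-refl (φ 𝔸 T (P C)))
      ; PG-int = λ D → from ⟦ G D ⟧ D (≤₁-refl (φ 𝔸 T (G D)))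
      }
      where open GaloisConnection gc

    galois⇒T1 : GaloisConnection 𝔸 T P G → T1 𝔸 T P G
    galois⇒T1 gc = record
      { P-mono = λ C D C≤₁D →
          from C ⟦ P D ⟧ (≤₁-trans (set C) (set D) _ C≤₁D (GP-ext D))
      ; G-mono = λ C D C≤₂D →
          to ⟦ G C ⟧ D (≤₂-trans _ (set C) (set D) (PG-int C) C≤₂D)
      }
      where
      open GaloisConnection gc
      open T2 (galois⇒T2 gc)

    T1×T2⇒galois : T1 𝔸 T P G → T2 𝔸 T P G → GaloisConnection 𝔸 T P G
    T1×T2⇒galois t1 t2 = record
      { to = λ C D PC≤₂D →
          ≤₁-trans (set C) _ _ (GP-ext C) (G-mono ⟦ P C ⟧ D PC≤₂D)
      ; from = λ C D C≤₁GD →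
          ≤₂-trans _ _ (set D) (P-mono C ⟦ G D ⟧ C≤₁GD) (PG-int D)
      }
      where
      open T1 t1
      open T2 t2

theorem3p18 : {c ℓ₁ ℓ₂ : Level} (𝔸 : BoundedPoset c ℓ₁ ℓ₂) (T : Set c) → (t₀ : T)
    → (P G : Map 𝔸 T)
    → GaloisConnection 𝔸 T P G ⇔ (T1 𝔸 T P G × T2 𝔸 T P G)
theorem3p18 𝔸 T _ P G = mk⇔
  (λ gc → galois⇒T1 𝔸 T gc , galois⇒T2 𝔸 T gc)
  (uncurry (T1×T2⇒galois 𝔸 T))
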